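{- Let $G=(V,E)$ be a finite loopless multigraph and let $(L,C)$ be a derangement assignment on $G$. Suppose $f_S:V\to\mathbb{N}$ is such that there exists a kernel-perfect biorientation $D_S$ of $G_S$ with $f_S(v)\geq d^+_{D_S}(v)+1$ for each $v\in V$. If $|L(v)|\geq f_S(v)+d_{G_T}(v)$ for each $v\in V$, then $G$ is $(L,C)$-colorable.
   Context: A biorientation of a multigraph $H$ is a digraph on $V(H)$ in which each edge $\{u,v\}$ of $H$ is replaced by the arc $(u,v)$, the arc $(v,u)$, or both. $d^+_{D}(v)$ is out-degree in $D$ and $d_{H}(v)$ is degree in $H$. A kernel of a digraph is an independent vertex set $U$ such that every vertex $v\notin U$ has an arc $(v,u)$ to some $u\in U$; a digraph is kernel-perfect if every induced subdigraph has a kernel. A correspondence assignment $(L,C)$ for $G$ consists of lists $L(v)$ for $v\in V$ and, for each edge $e=\{u,v\}$, a partial matching $C_e$ between $\{u\}\times L(u)$ and $\{v\}\times L(v)$. An $(L,C)$-coloring is a function $\varphi$ with $\varphi(v)\in L(v)$ for all $v$ such that for every edge $e=\{u,v\}$, $(u,\varphi(u))$ and $(v,\varphi(v))$ are not matched in $C_e$. An edge $e=\{u,v\}$ is straight if $\{(u,c_1),(v,c_2)\}\in C_e$ implies $c_1=c_2$, and twisted otherwise. $G_S=(V,E_S(G))$ and $G_T=(V,E_T(G))$ where $E_S(G)$, $E_T(G)$ are the sets of straight and twisted edges. $C_e$ (for $e=\{v,w\}$) is a partial derangement if $\{(v,c),(w,c)\}\notin C_e$ for all $c\in L(v)\cap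 L(w)$. $(L,C)$ is a derangement assignment if $C_e$ is a partial derangement for every twisted edge $e$. -}

module Defs where

open import Data.Nat using (ℕ; suc; _+_; _≤_)
open import Data.Nat.Properties using () renaming (_≟_ to _≟ℕ_)
open import Data.Fin using (Fin; _≟_)
open import Data.Fin.Subset using (Subset) renaming (_∈_ to _∈ₛ_; _∉_ to _∉ₛ_; _⊆_ to _⊆ₛ_)
open import Data.Sum using (_⊎_)
open import Data.Product using (_×_; _,_; proj₁; proj₂; ∃)
open import Data.List using (List; []; _∷_; length; filter; map; concatMap; lookup; allFin)
open import Data.List.Membership.Propositional using (_∈_; _∉_)
open import Data.List.Relation.Unary.All using (All; all?)
open import Data.List.Relation.Unary.Unique.Propositional using (Unique)
open import Relation.Nullary using (Dec; ¬_; ¬?)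
open import Relation.Nullary.Decidable using (_⊎-dec_; _×-dec_)
open import Relation.Unary using (Pred; Decidable)
open import Relation.Binary.PropositionalEquality using (_≡_; _≢_)
open import Level using (0ℓ)

record MG (n : ℕ) : Set where
  field
    m    : ℕ
    ends : Fin m → Fin n × Fin n
open MG public

Loopless : ∀ {n} → MG n → Set
Loopless G = ∀ e → proj₁ (ends G e) ≢ proj₂ (ends G e)

incident? : ∀ {n} (v : Fin n) (p : Fin n × Fin n) → Dec ((v ≡ proj₁ p) ⊎ (v ≡ proj₂ p))
incident? v (a , b) = (v ≟ a) ⊎-dec (v ≟ b)

-- degree of v in H (number of incident edges; H is loopless where used)
degree : ∀ {n} (H : MG n) → Fin n → ℕ
degree H v = length (filter (λ e → incident? v (ends H e)) (allFin (m H)))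

subMG : ∀ {n} (H : MG n) {P : Pred (Fin (m H)) 0ℓ} → Decidable P → MG n
subMG H P? = record { m = length idx ; ends = λ i → ends H (lookup idx i) }
  where idx = filter P? (allFin (m H))

-- Correspondence assignment (L,C) on G. Colours are natural numbers.
-- For edge e with ends (u , v), C e is the list of matched pairs (c₁ , c₂),
-- meaning {(u,c₁),(v,c₂)} ∈ C_e.
record CorrAssign {n} (G : MG n) : Set where
  field
    L        : Fin n → List ℕ
    L-set    : ∀ v → Unique (L v)
    C        : Fin (m G) → List (ℕ × ℕ)
    C-set    : ∀ e → Unique (C e)
    C-dom    : ∀ e c₁ c₂ → (c₁ , c₂) ∈ C e →
               c₁ ∈ L (proj₁ (ends G e)) × c₂ ∈ L (proj₂ (ends G e))
    -- partial matching: each (u,c) and each (v,c) lies in at most one pair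
    C-match₁ : ∀ e → Unique (map proj₁ (C e))
    C-match₂ : ∀ e → Unique (map proj₂ (C e))
open CorrAssign public

module _ {n} {G : MG n} (A : CorrAssign G) where

  Straight : Fin (m G) → Set
  Straight e = All (λ p → proj₁ p ≡ proj₂ p) (C A e)

  straight? : Decidable Straight
  straight? e = all? (λ p → proj₁ p ≟ℕ proj₂ p) (C A e)

  Twisted : Fin (m G) → Set
  Twisted e = ¬ Straight e

  twisted? : Decidable Twisted
  twisted? e = ¬? (straight? e)

  G-S : MG n
  G-S = subMG G straight?

  G-T : MG n
  G-T = subMG G twisted?

  Derangement : Set
  Derangement = ∀ e → Twisted e → ∀ c →
    c ∈ L A (proj₁ (ends G e)) → c ∈ L A (proj₂ (ends G e)) → (c , c) ∉ C A e

  IsColoring : (Fin n → ℕ) → Set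
  IsColoring φ = (∀ v → φ v ∈ L A v) ×
    (∀ e → (φ (proj₁ (ends G e)) , φ (proj₂ (ends G e))) ∉ C A e)

Digraph : ℕ → Set
Digraph n = List (Fin n × Fin n)

outdeg : ∀ {n} → Digraph n → Fin n → ℕ
outdeg D v = length (filter (λ a → proj₁ a ≟ v) D)

data Orient : Set where
  fwd bwd both : Orient

orientArcs : ∀ {n} → Fin n × Fin n → Orient → Digraph n
orientArcs (u , v) fwd  = (u , v) ∷ []
orientArcs (u , v) bwd  = (v , u) ∷ []
orientArcs (u , v) both = (u , v) ∷ (v , u) ∷ []

biorientation : ∀ {n} (H : MG n) → (Fin (m H) → Orient) → Digraph n
biorientation H o = concatMap (λ e → orientArcs (ends H e) (o e)) (allFin (m H))

IsKernelIn : ∀ {n} → Digraph n → Subset n → Subset n → Set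
IsKernelIn D W U =
  (U ⊆ₛ W) ×
  (∀ a b → a ∈ₛ U → b ∈ₛ U → (a , b) ∉ D) ×
  (∀ v → v ∈ₛ W → v ∉ₛ U → ∃ λ u → u ∈ₛ U × (v , u) ∈ D)

KernelPerfect : ∀ {n} → Digraph n → Set
KernelPerfect D = ∀ W → ∃ λ U → IsKernelIn D W U

module Submission where

-- Kernel method.  Colour in rounds, keeping at every uncoloured vertex x the slack
--   #(colours still allowed at x) > #(arcs of D_S from x to uncoloured vertices)
--                                   + #(twisted edges from x to uncoloured vertices).
-- In a round pick a colour c allowed at some uncoloured vertex, let W be the uncoloured
-- vertices where c is allowed, and give c to a kernel U of D_S[W].  No edge inside U is
-- violated: a straight one would be an arc inside the independent set U, a twisted one
-- cannot forbid (c , c) by the derangement condition.  An uncoloured x outside U loses c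
-- only if x ∈ W, and then it has an arc into U; straight edges into U forbid nothing but c,
-- and each twisted edge into U forbids at most one more colour since C_e is a matching.
-- So the slack survives while at least one vertex gets coloured.

open import Defs
open import Data.Nat using (ℕ; suc; _+_; _≤_; _<_; z≤n; s≤s) renaming (_≟_ to _≟ℕ_)
open import Data.Nat.Properties hiding (_≟_)
open import Data.Nat.Induction using (<-wellFounded)
open import Data.Nat.Tactic.RingSolver using (solve-∀)
open import Data.Bool using (true)
open import Data.Fin using (Fin; _≟_)
import Data.Fin.Properties as Fin
open import Data.Fin.Subset using (Subset) renaming (_∈_ to _∈ₛ_; _∉_ to _∉ₛ_)
open import Data.Fin.Subset.Properties using () renaming (_∈?_ to _∈ₛ?_)
open import Data.Maybe using (Maybe; just; nothing; fromMaybe)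
open import Data.Maybe.Properties using (just-injective)
import Data.Maybe.Properties as Maybe
open import Data.Product using (_×_; _,_; proj₁; proj₂; ∃; swap)
import Data.Product
open import Data.Product.Properties using () renaming (≡-dec to ×-≡-dec)
open import Data.Sum using (_⊎_; inj₁; inj₂; [_,_])
import Data.Sum
open import Data.Vec using (tabulate)
open import Data.Vec.Properties using (lookup∘tabulate; []=⇒lookup; lookup⇒[]=)
open import Data.List using (List; []; _∷_; length; filter; map; concatMap; lookup; allFin; _++_)
open import Data.List.Properties using (length-++; filter-++; filter-some; filter-all; map-∘; length-map; map-tabulate; tabulate-lookup)
open import Data.List.Membership.Propositional using (_∈_; _∉_; lose)
open import Data.List.Membership.Propositional.Properties
  using (∈-allFin; ∈-map⁺; ∈-map⁻; ∈-filter⁺; ∈-++⁺ˡ; ∈-++⁺ʳ; ∈-concat⁺′)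
import Data.List.Membership.DecPropositional as DecMembership
open import Data.List.Relation.Unary.Any using (here; there; index)
open import Data.List.Relation.Unary.Any.Properties using (lookup-index)
import Data.List.Relation.Unary.All as All
open import Data.List.Relation.Unary.Unique.Propositional using (Unique; []; _∷_)
open import Function using (_∘_; id)
open import Induction.WellFounded using (Acc; acc)
open import Level using (Level; 0ℓ)
open import Relation.Binary.Definitions using (DecidableEquality)
open import Relation.Binary.PropositionalEquality using (_≡_; _≢_; refl; sym; trans; cong; cong₂; subst; module ≡-Reasoning)
open import Relation.Nullary using (Dec; yes; no; does; ¬_; ¬?; contradiction)
open import Relation.Nullary.Decidable using (_×-dec_; _⊎-dec_; _→-dec_; map′; toSum)
open import Relation.Unary using (Pred; Decidable)

open DecMembership _≟ℕ_ using () renaming (_∈?_ to _∈ℕ?_)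
open DecMembership (×-≡-dec _≟ℕ_ _≟ℕ_) using () renaming (_∈?_ to _∈ℕ²?_)

private variable
  a b p q r : Level
  A B : Set a

count : {P : Pred A p} → Decidable P → List A → ℕ
count P? xs = length (filter P? xs)

module _ {P : Pred A p} (P? : Decidable P) where

  count-++ : ∀ xs ys → count P? (xs ++ ys) ≡ count P? xs + count P? ys
  count-++ xs ys rewrite filter-++ P? xs ys = length-++ (filter P? xs)

  count-map : (f : B → A) (xs : List B) → count P? (map f xs) ≡ count (P? ∘ f) xs
  count-map f [] = refl
  count-map f (x ∷ xs) with P? (f x)
  ... | yes _ = cong suc (count-map f xs)
  ... | no _  = count-map f xs

  count-none : ∀ xs → (∀ {x} → x ∈ xs → ¬ P x) → count P? xs ≡ 0
  count-none [] h = refl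
  count-none (x ∷ xs) h with P? x
  ... | yes px = contradiction px (h (here refl))
  ... | no _   = count-none xs (h ∘ there)

  count-≥1 : ∀ {x xs} → x ∈ xs → P x → 1 ≤ count P? xs
  count-≥1 x∈xs px = filter-some P? (lose x∈xs px)

  count-witness : ∀ xs → 1 ≤ count P? xs → ∃ λ x → x ∈ xs × P x
  count-witness (x ∷ xs) h with P? x
  ... | yes px = x , here refl , px
  ... | no _ with y , y∈xs , py ← count-witness xs h = y , there y∈xs , py

  count-≤1 : ∀ {xs} → Unique xs → (∀ {x y} → P x → P y → x ≡ y) → count P? xs ≤ 1
  count-≤1 {[]} [] _ = z≤n
  count-≤1 {x ∷ xs} (x∉xs ∷ u) P-unique with P? x
  ... | no _   = count-≤1 u P-unique
  ... | yes px = s≤s (≤-reflexive (count-none xs (λ y∈xs py → All.lookup x∉xs y∈xs (P-unique px py))))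

module _ {P : Pred A p} {Q : Pred A q} (P? : Decidable P) (Q? : Decidable Q) where

  count-mono : ∀ xs → (∀ {x} → x ∈ xs → P x → Q x) → count P? xs ≤ count Q? xs
  count-mono [] _ = z≤n
  count-mono (x ∷ xs) P⊆Q with P? x | Q? x
  ... | yes px | no ¬qx = contradiction (P⊆Q (here refl) px) ¬qx
  ... | yes _  | yes _  = s≤s (count-mono xs (P⊆Q ∘ there))
  ... | no _   | yes _  = m≤n⇒m≤1+n (count-mono xs (P⊆Q ∘ there))
  ... | no _   | no _   = count-mono xs (P⊆Q ∘ there)

  count-filter : ∀ xs →
    count Q? (filter P? xs) ≡ count (λ x → P? x ×-dec Q? x) xs
  count-filter [] = refl
  count-filter (x ∷ xs) with P? x
  ... | no _  = count-filter xs
  ... | yes _ with Q? x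
  ...   | yes _ = cong suc (count-filter xs)
  ...   | no _  = count-filter xs

  count-inclusion-exclusion : ∀ xs →
    count P? xs + count Q? xs ≡
    count (λ x → P? x ⊎-dec Q? x) xs + count (λ x → P? x ×-dec Q? x) xs
  count-inclusion-exclusion [] = refl
  count-inclusion-exclusion (x ∷ xs) with ih ← count-inclusion-exclusion xs | P? x | Q? x
  ... | yes _ | yes _ = cong suc (trans (+-suc _ _) (trans (cong suc ih) (sym (+-suc _ _))))
  ... | yes _ | no _  = cong suc ih
  ... | no _  | yes _ = trans (+-suc _ _) (cong suc ih)
  ... | no _  | no _  = ih

  count-⊎-≤ : ∀ xs → count (λ x → P? x ⊎-dec Q? x) xs ≤ count P? xs + count Q? xs
  count-⊎-≤ xs = ≤-trans (m≤m+n _ _) (≤-reflexive (sym (count-inclusion-exclusion xs)))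

  count-disjoint : ∀ xs → (∀ {x} → P x → ¬ Q x) →
    count P? xs + count Q? xs ≡ count (λ x → P? x ⊎-dec Q? x) xs
  count-disjoint xs P∩Q=∅ = begin
    count P? xs + count Q? xs                ≡⟨ count-inclusion-exclusion xs ⟩
    count P⊎Q? xs + count P×Q? xs            ≡⟨ cong (count P⊎Q? xs +_) (count-none P×Q? xs (λ _ (px , qx) → P∩Q=∅ px qx)) ⟩
    count P⊎Q? xs + 0                        ≡⟨ +-identityʳ _ ⟩
    count P⊎Q? xs                            ∎
    where
    open ≡-Reasoning
    P⊎Q? : Decidable (λ x → P x ⊎ Q x)
    P⊎Q? x = P? x ⊎-dec Q? x
    P×Q? : Decidable (λ x → P x × Q x)
    P×Q? x = P? x ×-dec Q? x

module _ {P : Pred A p} {Q : Pred A q} {R : Pred A r}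
         (P? : Decidable P) (Q? : Decidable Q) (R? : Decidable R) where

  count-cover : ∀ xs → (∀ {x} → x ∈ xs → R x → ¬ Q x → P x) →
    count R? xs ≤ count P? xs + count Q? xs
  count-cover xs R⊆P∪Q = ≤-trans (count-mono R? (λ x → P? x ⊎-dec Q? x) xs split) (count-⊎-≤ P? Q? xs)
    where
    split : ∀ {x} → x ∈ xs → R x → P x ⊎ Q x
    split {x} x∈xs rx with Q? x
    ... | yes qx = inj₂ qx
    ... | no ¬qx = inj₁ (R⊆P∪Q x∈xs rx ¬qx)

  count-disjoint-≤ : ∀ xs → (∀ {x} → P x → R x) → (∀ {x} → Q x → R x) → (∀ {x} → P x → ¬ Q x) →
    count P? xs + count Q? xs ≤ count R? xs
  count-disjoint-≤ xs P⊆R Q⊆R P∩Q=∅ = begin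
    count P? xs + count Q? xs                  ≡⟨ count-disjoint P? Q? xs P∩Q=∅ ⟩
    count (λ x → P? x ⊎-dec Q? x) xs           ≤⟨ count-mono _ R? xs (λ _ → [ P⊆R , Q⊆R ]) ⟩
    count R? xs                                ∎
    where open ≤-Reasoning

module _ {A : Set a} (_≟_ : DecidableEquality A) where
  open import Data.List.Membership.DecPropositional _≟_ using (_∈?_)

  count-∈-≤-length : ∀ {xs} → Unique xs → ∀ ys → count (_∈? ys) xs ≤ length ys
  count-∈-≤-length {xs} u [] = ≤-reflexive (count-none _ xs λ _ ())
  count-∈-≤-length {xs} u (y ∷ ys) = ≤-trans
    (count-cover (_≟ y) (_∈? ys) (_∈? (y ∷ ys)) xs λ { _ (here x≡y) _ → x≡y ; _ (there x∈ys) x∉ys → contradiction x∈ys x∉ys })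
    (+-mono-≤ (count-≤1 (_≟ y) u λ { refl refl → refl }) (count-∈-≤-length u ys))

length-concatMap-≤ : (f : A → List B) → (∀ x → length (f x) ≤ 1) → ∀ xs → length (concatMap f xs) ≤ length xs
length-concatMap-≤ f short [] = z≤n
length-concatMap-≤ f short (x ∷ xs) =
  ≤-trans (≤-reflexive (length-++ (f x))) (+-mono-≤ (short x) (length-concatMap-≤ f short xs))

module _ {X : Set b} {B : Pred A p} {Y₁ Y₂ Y : Pred X q}
         (B? : Decidable B) (h : A → X) (Y₁? : Decidable Y₁) (Y₂? : Decidable Y₂) (Y? : Decidable Y) where

  count-restrict-disjoint : ∀ xs → (∀ {y} → Y₁ y → Y y) → (∀ {y} → Y₂ y → Y y) → (∀ {y} → Y₁ y → ¬ Y₂ y) →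
    count (λ x → B? x ×-dec Y₁? (h x)) xs + count (λ x → B? x ×-dec Y₂? (h x)) xs ≤
    count (λ x → B? x ×-dec Y? (h x)) xs
  count-restrict-disjoint xs Y₁⊆Y Y₂⊆Y Y₁∩Y₂=∅ = count-disjoint-≤ _ _ _ xs
    (Data.Product.map₂ Y₁⊆Y) (Data.Product.map₂ Y₂⊆Y) (λ (_ , y₁) (_ , y₂) → Y₁∩Y₂=∅ y₁ y₂)

module _ {n} {P : Pred (Fin n) 0ℓ} (P? : Decidable P) where

  toSubset : Subset n
  toSubset = tabulate (does ∘ P?)

  ∈-toSubset⁺ : ∀ {x} → P x → x ∈ₛ toSubset
  ∈-toSubset⁺ {x} px = lookup⇒[]= x _ (trans (lookup∘tabulate (does ∘ P?) x) (accept (P? x)))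
    where
    accept : (d : Dec (P x)) → does d ≡ true
    accept (yes _) = refl
    accept (no ¬px) = contradiction px ¬px

  ∈-toSubset⁻ : ∀ {x} → x ∈ₛ toSubset → P x
  ∈-toSubset⁻ {x} x∈ with P? x | trans (sym (lookup∘tabulate (does ∘ P?) x)) ([]=⇒lookup x∈)
  ... | yes px | _ = px
  ... | no _ | ()

module _ {n} (H : MG n) {P : Pred (Fin (m H)) 0ℓ} (P? : Decidable P) where

  private
    kept : List (Fin (m H))
    kept = filter P? (allFin (m H))

  subMG-contains : ∀ {e} → P e → ∃ λ i → ends (subMG H P?) i ≡ ends H e
  subMG-contains {e} pe = index e∈ , cong (ends H) (sym (lookup-index e∈))
    where
    e∈ : e ∈ kept
    e∈ = ∈-filter⁺ P? (∈-allFin e) pe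

  degree-subMG : ∀ v → degree (subMG H P?) v ≡ count (λ e → P? e ×-dec incident? v (ends H e)) (allFin (m H))
  degree-subMG v = begin
    count (incidence ∘ lookup kept) (allFin (length kept))
      ≡⟨ count-map incidence (lookup kept) (allFin (length kept)) ⟨
    count incidence (map (lookup kept) (allFin (length kept)))
      ≡⟨ cong (count incidence) (trans (map-tabulate id (lookup kept)) (tabulate-lookup kept)) ⟩
    count incidence kept
      ≡⟨ count-filter P? incidence (allFin (m H)) ⟩
    count (λ e → P? e ×-dec incidence e) (allFin (m H))
      ∎
    where
    open ≡-Reasoning
    incidence : Decidable (λ e → (v ≡ proj₁ (ends H e)) ⊎ (v ≡ proj₂ (ends H e)))
    incidence = incident? v ∘ ends H

orientArcs-joins : ∀ {n} (p : Fin n × Fin n) t → p ∈ orientArcs p t ⊎ swap p ∈ orientArcs p t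
orientArcs-joins _ fwd  = inj₁ (here refl)
orientArcs-joins _ bwd  = inj₂ (here refl)
orientArcs-joins _ both = inj₁ (here refl)

∈-biorientation : ∀ {n} (H : MG n) o e {a} → a ∈ orientArcs (ends H e) (o e) → a ∈ biorientation H o
∈-biorientation H o e a∈ = ∈-concat⁺′ a∈ (∈-map⁺ (λ e → orientArcs (ends H e) (o e)) (∈-allFin e))

biorientation-joins : ∀ {n} (H : MG n) o e → ends H e ∈ biorientation H o ⊎ swap (ends H e) ∈ biorientation H o
biorientation-joins H o e = Data.Sum.map (∈-biorientation H o e) (∈-biorientation H o e) (orientArcs-joins (ends H e) (o e))

slack-transfer : ∀ {o t a o′ t′ a′ k l lₖ lₗ} →
  suc (o + t) ≤ a → o′ + k ≤ o → t′ + l ≤ t → a ≤ a′ + (lₖ + lₗ) → lₖ ≤ k → lₗ ≤ l →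
  suc (o′ + t′) ≤ a′
slack-transfer {o} {t} {a} {o′} {t′} {a′} {k} {l} {lₖ} {lₗ} slack o-split t-split a-loss lₖ≤k lₗ≤l =
  +-cancelʳ-≤ (k + l) (suc (o′ + t′)) a′ (begin
    suc (o′ + t′) + (k + l)   ≡⟨ rearrange o′ t′ k l ⟩
    suc (o′ + k + (t′ + l))   ≤⟨ s≤s (+-mono-≤ o-split t-split) ⟩
    suc (o + t)               ≤⟨ slack ⟩
    a                         ≤⟨ a-loss ⟩
    a′ + (lₖ + lₗ)            ≤⟨ +-monoʳ-≤ a′ (+-mono-≤ lₖ≤k lₗ≤l) ⟩
    a′ + (k + l)              ∎)
  where
  open ≤-Reasoning
  rearrange : ∀ o′ t′ k l → suc (o′ + t′) + (k + l) ≡ suc (o′ + k + (t′ + l))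
  rearrange = solve-∀

module KernelMethod {n} (G : MG n) (loopless : Loopless G) (A : CorrAssign G) (deranged : Derangement A)
  (o : Fin (m (G-S A)) → Orient) (kernel-perfect : KernelPerfect (biorientation (G-S A) o)) where

  D : Digraph n
  D = biorientation (G-S A) o

  edges : List (Fin (m G))
  edges = allFin (m G)

  src tgt : Fin (m G) → Fin n
  src e = proj₁ (ends G e)
  tgt e = proj₂ (ends G e)

  straight-joined : ∀ {e} → Straight A e → (src e , tgt e) ∈ D ⊎ (tgt e , src e) ∈ D
  straight-joined s with i , ends≡ ← subMG-contains G (straight? A) s =
    subst (λ p → p ∈ D ⊎ swap p ∈ D) ends≡ (biorientation-joins (G-S A) o i)

  data Side : Set where
    forward backward : Side

  Dart : Set
  Dart = Fin (m G) × Side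

  edge : Dart → Fin (m G)
  edge = proj₁

  tail head : Dart → Fin n
  tail (e , forward)  = src e
  tail (e , backward) = tgt e
  head (e , forward)  = tgt e
  head (e , backward) = src e

  conflicts : Dart → List (ℕ × ℕ)
  conflicts (e , forward)  = C A e
  conflicts (e , backward) = map swap (C A e)

  darts : List Dart
  darts = map (_, forward) edges ++ map (_, backward) edges

  ∈-darts : ∀ δ → δ ∈ darts
  ∈-darts (e , forward)  = ∈-++⁺ˡ (∈-map⁺ (_, forward) (∈-allFin e))
  ∈-darts (e , backward) = ∈-++⁺ʳ (map (_, forward) edges) (∈-map⁺ (_, backward) (∈-allFin e))

  all-darts? : {Q : Dart → Set} → (∀ δ → Dec (Q δ)) → Dec (∀ δ → Q δ)
  all-darts? {Q} Q? = map′ split (λ all e → all (e , forward) , all (e , backward))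
                           (Fin.all? λ e → Q? (e , forward) ×-dec Q? (e , backward))
    where
    split : (∀ e → Q (e , forward) × Q (e , backward)) → ∀ δ → Q δ
    split each (e , forward)  = proj₁ (each e)
    split each (e , backward) = proj₂ (each e)

  conflicts-straight : ∀ δ → Straight A (edge δ) → ∀ {c d} → (c , d) ∈ conflicts δ → c ≡ d
  conflicts-straight (e , forward)  s cd∈ = All.lookup s cd∈
  conflicts-straight (e , backward) s cd∈ with _ , dc∈ , refl ← ∈-map⁻ swap cd∈ = sym (All.lookup s dc∈)

  conflicts-matching : ∀ δ → Unique (map proj₂ (conflicts δ))
  conflicts-matching (e , forward)  = C-match₂ A e
  conflicts-matching (e , backward) = subst Unique (map-∘ (C A e)) (C-match₁ A e)

  partners : ℕ → Dart → List ℕ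
  partners c δ = map proj₁ (filter ((_≟ℕ c) ∘ proj₂) (conflicts δ))

  partners-≤1 : ∀ c δ → length (partners c δ) ≤ 1
  partners-≤1 c δ = begin
    length (partners c δ)                     ≡⟨ length-map proj₁ (filter ((_≟ℕ c) ∘ proj₂) (conflicts δ)) ⟩
    count ((_≟ℕ c) ∘ proj₂) (conflicts δ)     ≡⟨ count-map (_≟ℕ c) proj₂ (conflicts δ) ⟨
    count (_≟ℕ c) (map proj₂ (conflicts δ))   ≤⟨ count-≤1 (_≟ℕ c) (conflicts-matching δ) (λ { refl refl → refl }) ⟩
    1                                         ∎
    where open ≤-Reasoning

  ∈-partners : ∀ {c d} δ → (d , c) ∈ conflicts δ → d ∈ partners c δ
  ∈-partners {c} δ d∈ = ∈-map⁺ proj₁ (∈-filter⁺ ((_≟ℕ c) ∘ proj₂) d∈ refl)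

  Partial : Set
  Partial = Fin n → Maybe ℕ

  uncoloured? : (ψ : Partial) → Decidable (λ x → ψ x ≡ nothing)
  uncoloured? ψ x = Maybe.≡-dec _≟ℕ_ (ψ x) nothing

  Allowed : Partial → Fin n → ℕ → Set
  Allowed ψ x c = ∀ δ {d} → tail δ ≡ x → ψ (head δ) ≡ just d → (c , d) ∉ conflicts δ

  allowed? : ∀ ψ x → Decidable (Allowed ψ x)
  allowed? ψ x c = all-darts? across?
    where
    across? : ∀ δ → Dec (∀ {d} → tail δ ≡ x → ψ (head δ) ≡ just d → (c , d) ∉ conflicts δ)
    across? δ with ψ (head δ)
    ... | nothing = yes λ _ ()
    ... | just d  = map′ (λ h t → λ { refl → h t }) (λ h t → h t refl)
                         ((tail δ ≟ x) →-dec ¬? ((c , d) ∈ℕ²? conflicts δ))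

  outdegInto : {Y : Pred (Fin n) 0ℓ} → Decidable Y → Fin n → ℕ
  outdegInto Y? x = count (λ a → (proj₁ a ≟ x) ×-dec Y? (proj₂ a)) D

  TwistedFromInto : Pred (Fin n) 0ℓ → Fin n → Pred Dart 0ℓ
  TwistedFromInto Y x δ = (Twisted A (edge δ) × tail δ ≡ x) × Y (head δ)

  twistedFromInto? : {Y : Pred (Fin n) 0ℓ} → Decidable Y → ∀ x → Decidable (TwistedFromInto Y x)
  twistedFromInto? Y? x δ = (twisted? A (edge δ) ×-dec (tail δ ≟ x)) ×-dec Y? (head δ)

  twistedDegInto : {Y : Pred (Fin n) 0ℓ} → Decidable Y → Fin n → ℕ
  twistedDegInto Y? x = count (twistedFromInto? Y? x) darts

  available : Partial → Fin n → ℕ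
  available ψ x = count (allowed? ψ x) (L A x)

  #uncoloured : Partial → ℕ
  #uncoloured ψ = count (uncoloured? ψ) (allFin n)

  record Invariant (ψ : Partial) : Set where
    field
      colour-in-list : ∀ {x c} → ψ x ≡ just c → c ∈ L A x
      proper         : ∀ e {c d} → ψ (src e) ≡ just c → ψ (tgt e) ≡ just d → (c , d) ∉ C A e
      slack          : ∀ {x} → ψ x ≡ nothing →
                       suc (outdegInto (uncoloured? ψ) x + twistedDegInto (uncoloured? ψ) x) ≤ available ψ x

  Candidate : Partial → ℕ → Fin n → Set
  Candidate ψ c x = ψ x ≡ nothing × c ∈ L A x × Allowed ψ x c

  candidate? : ∀ ψ c → Decidable (Candidate ψ c)
  candidate? ψ c x = uncoloured? ψ x ×-dec (c ∈ℕ? L A x) ×-dec allowed? ψ x c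

  paint : Subset n → ℕ → Partial → Partial
  paint U c ψ x with x ∈ₛ? U
  ... | yes _ = just c
  ... | no _  = ψ x

  paint-∈ : ∀ {U c ψ x} → x ∈ₛ U → paint U c ψ x ≡ just c
  paint-∈ {U} {x = x} x∈U with x ∈ₛ? U
  ... | yes _   = refl
  ... | no x∉U = contradiction x∈U x∉U

  paint-∉ : ∀ {U c ψ x} → x ∉ₛ U → paint U c ψ x ≡ ψ x
  paint-∉ {U} {x = x} x∉U with x ∈ₛ? U
  ... | yes x∈U = contradiction x∈U x∉U
  ... | no _    = refl

  module Recolour {ψ : Partial} (inv : Invariant ψ) {c : ℕ} {U : Subset n}
    (U-candidates : ∀ {x} → x ∈ₛ U → Candidate ψ c x)
    (U-independent : ∀ {a b} → a ∈ₛ U → b ∈ₛ U → (a , b) ∉ D)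
    (U-absorbing : ∀ {x} → Candidate ψ c x → x ∉ₛ U → ∃ λ u → u ∈ₛ U × (x , u) ∈ D) where

    open Invariant inv

    ψ′ : Partial
    ψ′ = paint U c ψ

    inside? : ∀ x → x ∈ₛ U ⊎ x ∉ₛ U
    inside? x = toSum (x ∈ₛ? U)

    painted : ∀ {x d} → x ∈ₛ U → ψ′ x ≡ just d → d ≡ c
    painted x∈U eq = just-injective (trans (sym eq) (paint-∈ x∈U))

    unpainted : ∀ {x} → x ∉ₛ U → ψ′ x ≡ ψ x
    unpainted = paint-∉

    U-coloured : ∀ {x} → x ∈ₛ U → ψ′ x ≢ nothing
    U-coloured x∈U eq with () ← trans (sym (paint-∈ x∈U)) eq

    U-uncoloured : ∀ {x} → x ∈ₛ U → ψ x ≡ nothing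
    U-uncoloured = proj₁ ∘ U-candidates

    still-uncoloured : ∀ {x} → ψ′ x ≡ nothing → x ∉ₛ U × ψ x ≡ nothing
    still-uncoloured {x} eq with inside? x
    ... | inj₁ x∈U = contradiction eq (U-coloured x∈U)
    ... | inj₂ x∉U  = x∉U , trans (sym (unpainted x∉U)) eq

    colour-in-list′ : ∀ {x d} → ψ′ x ≡ just d → d ∈ L A x
    colour-in-list′ {x} eq with inside? x
    ... | inj₁ x∈U rewrite painted x∈U eq = proj₁ (proj₂ (U-candidates x∈U))
    ... | inj₂ x∉U  = colour-in-list (trans (sym (unpainted x∉U)) eq)

    monochromatic-proper : ∀ e → src e ∈ₛ U → tgt e ∈ₛ U → (c , c) ∉ C A e
    monochromatic-proper e s∈U t∈U cc∈ with straight? A e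
    ... | yes s = [ U-independent s∈U t∈U , U-independent t∈U s∈U ] (straight-joined s)
    ... | no t  = deranged e t c (proj₁ (proj₂ (U-candidates s∈U))) (proj₁ (proj₂ (U-candidates t∈U))) cc∈

    proper′ : ∀ e {c₁ c₂} → ψ′ (src e) ≡ just c₁ → ψ′ (tgt e) ≡ just c₂ → (c₁ , c₂) ∉ C A e
    proper′ e eq₁ eq₂ with inside? (src e) | inside? (tgt e)
    ... | inj₁ s∈U | inj₁ t∈U rewrite painted s∈U eq₁ | painted t∈U eq₂ = monochromatic-proper e s∈U t∈U
    ... | inj₁ s∈U | inj₂ t∉U rewrite painted s∈U eq₁ =
      proj₂ (proj₂ (U-candidates s∈U)) (e , forward) refl (trans (sym (unpainted t∉U)) eq₂)
    ... | inj₂ s∉U | inj₁ t∈U rewrite painted t∈U eq₂ =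
      proj₂ (proj₂ (U-candidates t∈U)) (e , backward) refl (trans (sym (unpainted s∉U)) eq₁) ∘ ∈-map⁺ swap
    ... | inj₂ s∉U | inj₂ t∉U =
      proper e (trans (sym (unpainted s∉U)) eq₁) (trans (sym (unpainted t∉U)) eq₂)

    lost-partners : Fin n → List ℕ
    lost-partners x = concatMap (partners c) (filter (twistedFromInto? (_∈ₛ? U) x) darts)

    allowed-kept : ∀ {x d} → Allowed ψ x d → d ≢ c → d ∉ lost-partners x → Allowed ψ′ x d
    allowed-kept {x} {d} allowed d≢c d∉lost δ tail≡x eq dd′∈ with inside? (head δ)
    ... | inj₂ h∉U = allowed δ tail≡x (trans (sym (unpainted h∉U)) eq) dd′∈
    ... | inj₁ h∈U rewrite painted h∈U eq with straight? A (edge δ)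
    ...   | yes s = d≢c (conflicts-straight δ s dd′∈)
    ...   | no t  = d∉lost (∈-concat⁺′ (∈-partners δ dd′∈)
                      (∈-map⁺ (partners c) (∈-filter⁺ (twistedFromInto? (_∈ₛ? U) x) (∈-darts δ) ((t , tail≡x) , h∈U))))

    lost-c? : ∀ x → Decidable (λ d → d ≡ c × Allowed ψ x d)
    lost-c? x d = (d ≟ℕ c) ×-dec allowed? ψ x d

    available-loss : ∀ x → available ψ x ≤
      available ψ′ x + (count (lost-c? x) (L A x) + count (_∈ℕ? lost-partners x) (L A x))
    available-loss x = ≤-trans
      (count-cover (allowed? ψ′ x) (λ d → lost-c? x d ⊎-dec d ∈ℕ? lost-partners x) (allowed? ψ x) (L A x)
        λ _ allowed not-lost → allowed-kept allowed (λ d≡c → not-lost (inj₁ (d≡c , allowed))) (not-lost ∘ inj₂))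
      (+-monoʳ-≤ (available ψ′ x) (count-⊎-≤ (lost-c? x) (_∈ℕ? lost-partners x) (L A x)))

    lost-c-≤ : ∀ {x} → x ∉ₛ U → ψ x ≡ nothing → count (lost-c? x) (L A x) ≤ outdegInto (_∈ₛ? U) x
    lost-c-≤ {x} x∉U xu = ≤1-≤ (count-≤1 (lost-c? x) (L-set A x) λ { (refl , _) (refl , _) → refl }) arc
      where
      ≤1-≤ : ∀ {i j} → i ≤ 1 → (1 ≤ i → 1 ≤ j) → i ≤ j
      ≤1-≤ {0} _ _ = z≤n
      ≤1-≤ {1} _ h = h ≤-refl
      ≤1-≤ {suc (suc _)} (s≤s ()) _
      arc : 1 ≤ count (lost-c? x) (L A x) → 1 ≤ outdegInto (_∈ₛ? U) x
      arc lost with _ , c∈ , refl , allowed ← count-witness (lost-c? x) (L A x) lost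
               with _ , u∈U , xu∈D ← U-absorbing (xu , c∈ , allowed) x∉U
        = count-≥1 (λ a → (proj₁ a ≟ x) ×-dec (proj₂ a ∈ₛ? U)) xu∈D (refl , u∈U)

    lost-partners-≤ : ∀ x → count (_∈ℕ? lost-partners x) (L A x) ≤ twistedDegInto (_∈ₛ? U) x
    lost-partners-≤ x = ≤-trans (count-∈-≤-length _≟ℕ_ (L-set A x) (lost-partners x))
      (length-concatMap-≤ (partners c) (partners-≤1 c) (filter (twistedFromInto? (_∈ₛ? U) x) darts))

    out-split : ∀ x → outdegInto (uncoloured? ψ′) x + outdegInto (_∈ₛ? U) x ≤ outdegInto (uncoloured? ψ) x
    out-split x = count-restrict-disjoint (λ a → proj₁ a ≟ x) proj₂ (uncoloured? ψ′) (_∈ₛ? U) (uncoloured? ψ) D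
      (proj₂ ∘ still-uncoloured) U-uncoloured (λ u′ y∈U → U-coloured y∈U u′)

    twisted-split : ∀ x → twistedDegInto (uncoloured? ψ′) x + twistedDegInto (_∈ₛ? U) x ≤ twistedDegInto (uncoloured? ψ) x
    twisted-split x = count-restrict-disjoint (λ δ → twisted? A (edge δ) ×-dec (tail δ ≟ x)) head
      (uncoloured? ψ′) (_∈ₛ? U) (uncoloured? ψ) darts
      (proj₂ ∘ still-uncoloured) U-uncoloured (λ u′ y∈U → U-coloured y∈U u′)

    slack′ : ∀ {x} → ψ′ x ≡ nothing →
             suc (outdegInto (uncoloured? ψ′) x + twistedDegInto (uncoloured? ψ′) x) ≤ available ψ′ x
    slack′ {x} xu′ with x∉U , xu ← still-uncoloured xu′ =
      slack-transfer (slack xu) (out-split x) (twisted-split x) (available-loss x) (lost-c-≤ x∉U xu) (lost-partners-≤ x)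

    invariant′ : Invariant ψ′
    invariant′ = record { colour-in-list = colour-in-list′ ; proper = proper′ ; slack = slack′ }

    progress : ∀ {v} → Candidate ψ c v → #uncoloured ψ′ < #uncoloured ψ
    progress {v} v-candidate = begin-strict
      #uncoloured ψ′
        <⟨ m<n+m (#uncoloured ψ′) U-nonempty ⟩
      count (_∈ₛ? U) (allFin n) + #uncoloured ψ′
        ≤⟨ count-disjoint-≤ (_∈ₛ? U) (uncoloured? ψ′) (uncoloured? ψ) (allFin n)
             U-uncoloured (proj₂ ∘ still-uncoloured) U-coloured ⟩
      #uncoloured ψ
        ∎
      where
      open ≤-Reasoning
      U-nonempty : 0 < count (_∈ₛ? U) (allFin n)
      U-nonempty with inside? v
      ... | inj₁ v∈U = count-≥1 (_∈ₛ? U) (∈-allFin v) v∈U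
      ... | inj₂ v∉U with u , u∈U , _ ← U-absorbing v-candidate v∉U = count-≥1 (_∈ₛ? U) (∈-allFin u) u∈U

  step : ∀ {ψ v} → Invariant ψ → ψ v ≡ nothing → ∃ λ ψ′ → Invariant ψ′ × #uncoloured ψ′ < #uncoloured ψ
  step {ψ} {v} inv vu
    with c , c∈ , c-allowed ← count-witness (allowed? ψ v) (L A v) (≤-trans (s≤s z≤n) (Invariant.slack inv vu))
    with U , U⊆W , U-independent , U-absorbing ← kernel-perfect (toSubset (candidate? ψ c))
    = ψ′ , invariant′ , progress (vu , c∈ , c-allowed)
    where
    open Recolour inv (∈-toSubset⁻ (candidate? ψ c) ∘ U⊆W) (U-independent _ _)
                      (λ x-candidate x∉U → U-absorbing _ (∈-toSubset⁺ (candidate? ψ c) x-candidate) x∉U)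

  complete : ∀ ψ → Acc _<_ (#uncoloured ψ) → Invariant ψ → ∃ λ φ → IsColoring A φ
  complete ψ (acc smaller) inv with Fin.any? (uncoloured? ψ)
  ... | yes (v , vu) = let ψ′ , inv′ , fewer = step inv vu in complete ψ′ (smaller fewer) inv′
  ... | no none = φ , (λ x → colour-in-list (coloured x)) , (λ e → proper e (coloured (src e)) (coloured (tgt e)))
    where
    open Invariant inv
    φ : Fin n → ℕ
    φ x = fromMaybe 0 (ψ x)
    coloured : ∀ x → ψ x ≡ just (φ x)
    coloured x with ψ x in eq
    ... | just _  = refl
    ... | nothing = contradiction (x , eq) none

  blank : Partial
  blank _ = nothing

  -- Looplessness makes the darts leaving x correspond to the edges at x.
  twistedDegInto-≤-degree : ∀ {Y} (Y? : Decidable Y) x → twistedDegInto Y? x ≤ degree (G-T A) x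
  twistedDegInto-≤-degree Y? x = begin
    twistedDegInto Y? x
      ≤⟨ count-mono (twistedFromInto? Y? x) tw-from? darts (λ _ → proj₁) ⟩
    count tw-from? (map (_, forward) edges ++ map (_, backward) edges)
      ≡⟨ count-++ tw-from? (map (_, forward) edges) (map (_, backward) edges) ⟩
    count tw-from? (map (_, forward) edges) + count tw-from? (map (_, backward) edges)
      ≡⟨ cong₂ _+_ (count-map tw-from? (_, forward) edges) (count-map tw-from? (_, backward) edges) ⟩
    count (tw-from? ∘ (_, forward)) edges + count (tw-from? ∘ (_, backward)) edges
      ≤⟨ count-disjoint-≤ _ _ tw-incident? edges (Data.Product.map₂ (inj₁ ∘ sym)) (Data.Product.map₂ (inj₂ ∘ sym))
           (λ (_ , src≡x) (_ , tgt≡x) → loopless _ (trans src≡x (sym tgt≡x))) ⟩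
    count tw-incident? edges
      ≡⟨ degree-subMG G (twisted? A) x ⟨
    degree (G-T A) x
      ∎
    where
    open ≤-Reasoning
    tw-from? : Decidable (λ δ → Twisted A (edge δ) × tail δ ≡ x)
    tw-from? δ = twisted? A (edge δ) ×-dec (tail δ ≟ x)
    tw-incident? : Decidable (λ e → Twisted A e × ((x ≡ src e) ⊎ (x ≡ tgt e)))
    tw-incident? e = twisted? A e ×-dec incident? x (ends G e)

  blank-invariant : (∀ x → suc (outdeg D x) + degree (G-T A) x ≤ length (L A x)) → Invariant blank
  blank-invariant large = record { colour-in-list = λ () ; proper = λ _ () ; slack = slack₀ }
    where
    slack₀ : ∀ {x} → blank x ≡ nothing →
             suc (outdegInto (uncoloured? blank) x + twistedDegInto (uncoloured? blank) x) ≤ available blank x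
    slack₀ {x} _ = begin
      suc (outdegInto (uncoloured? blank) x + twistedDegInto (uncoloured? blank) x)
        ≤⟨ s≤s (+-mono-≤ (count-mono _ (λ a → proj₁ a ≟ x) D (λ _ → proj₁)) (twistedDegInto-≤-degree (uncoloured? blank) x)) ⟩
      suc (outdeg D x) + degree (G-T A) x
        ≤⟨ large x ⟩
      length (L A x)
        ≡⟨ cong length (filter-all (allowed? blank x) {L A x} (All.tabulate λ _ _ _ ())) ⟨
      available blank x
        ∎
      where open ≤-Reasoning

  colouring : (∀ x → suc (outdeg D x) + degree (G-T A) x ≤ length (L A x)) → ∃ λ φ → IsColoring A φ
  colouring large = complete blank (<-wellFounded _) (blank-invariant large)

corollary5p1 : ∀ {n} (G : MG n) → Loopless G → (A : CorrAssign G) → Derangement A →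
    (fS : Fin n → ℕ) →
    (∃ λ (o : Fin (m (G-S A)) → Orient) →
       KernelPerfect (biorientation (G-S A) o) ×
       (∀ v → suc (outdeg (biorientation (G-S A) o) v) ≤ fS v)) →
    (∀ v → fS v + degree (G-T A) v ≤ length (L A v)) →
    ∃ λ (φ : Fin n → ℕ) → IsColoring A φ
corollary5p1 G loopless A deranged fS (o , kernel-perfect , out<fS) large =
  KernelMethod.colouring G loopless A deranged o kernel-perfect
    (λ v → ≤-trans (+-monoˡ-≤ (degree (G-T A) v) (out<fS v)) (large v))
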